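{- Let $n\in\mathbb{N}$ and $s\in\mathbb{C}\setminus\{ -1,-2,-3,\dots\}$. Then \[ \sum_{k=1}^{n}\binom{s+n}{k}\frac{(-1)^{k-1}}{k^2}=\frac{H_n^2+H_n^{(2)}}{2}+s\sum_{k=0}^{n-1}\frac{(-1)^k}{k+1}\binom{s+k}{k}\frac{H_n-H_k}{(n-k)\binom{n}{k}}. \]
   Context: For $m\in\mathbb{N}_0$, $H_m^{(r)}=\sum_{j=1}^{m}\frac{1}{j^r}$ (with $H_0^{(r)}=0$) and $H_m=H_m^{(1)}$. For $z\in\mathbb{C}$ and $k\in\mathbb{N}_0$, $\binom{z}{k}=\frac{z(z-1)\cdots(z-k+1)}{k!}$. -}

module Defs where

open import Level using (_⊔_) renaming (suc to lsuc)
open import Algebra.Bundles using (CommutativeRing)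
open import Data.Nat as ℕ using (ℕ; zero; suc; _∸_)
open import Data.Nat.Base using (_!)
open import Relation.Nullary using (¬_)

-- A field of characteristic zero (ℂ is the intended instance).
ringι : ∀ {c ℓ} (R : CommutativeRing c ℓ) → ℕ → CommutativeRing.Carrier R
ringι R zero    = CommutativeRing.0# R
ringι R (suc n) = CommutativeRing._+_ R (CommutativeRing.1# R) (ringι R n)

record CharZeroField (c ℓ : Level.Level) : Set (lsuc (c ⊔ ℓ)) where
  field
    cring : CommutativeRing c ℓ
  open CommutativeRing cring public
  field
    _⁻¹      : Carrier → Carrier
    inverseˡ : ∀ x → ¬ (x ≈ 0#) → (x ⁻¹) * x ≈ 1#
    inverseʳ : ∀ x → ¬ (x ≈ 0#) → x * (x ⁻¹) ≈ 1#
    char0    : ∀ n → ¬ (ringι cring (suc n) ≈ 0#)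

  ι : ℕ → Carrier
  ι = ringι cring


module FieldOps {c ℓ} (F : CharZeroField c ℓ) where
  open CharZeroField F public

  infixl 7 _/_
  _/_ : Carrier → Carrier → Carrier
  x / y = x * (y ⁻¹)

  sgn : ℕ → Carrier
  sgn zero    = 1#
  sgn (suc k) = - sgn k

  sumTo : ℕ → (ℕ → Carrier) → Carrier
  sumTo zero    f = 0#
  sumTo (suc n) f = sumTo n f + f n

  falling : Carrier → ℕ → Carrier
  falling z zero    = 1#
  falling z (suc k) = falling z k * (z - ι k)

  binom : Carrier → ℕ → Carrier
  binom z k = falling z k / ι (k !)

  Hr : ℕ → ℕ → Carrier
  Hr r m = sumTo m (λ j → 1# / ι (suc j ℕ.^ r))

  H : ℕ → Carrier
  H m = Hr 1 m

module Submission where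

-- Put a k s = (-1)^k C(s+k,k+1), which equals s (-1)^k/(k+1) C(s+k,k), and
-- W n k = (H_n - H_k)/((n-k) C(n,k)), A n = (H_n^2 + H_n^(2))/2, so that the
-- right-hand side is A n + Σ_{k<n} a k s · W n k.  The left-hand side L n s
-- obviously satisfies L (n+1) s = L n (s+1) + a n (s+1)/(n+1)^2.  The right-hand
-- side satisfies the same recurrence: Pascal's rule gives
-- a k s = a k (s+1) - (-1)^k C(s+k,k), and the second part, reindexed, telescopes
-- against the weights because W (n+1) k + W (n+1) (k+1) = W n k,
-- W (n+1) n = 1/(n+1)^2 and A (n+1) = A n + W (n+1) 0.  Both sides vanish at
-- n = 0, so induction on n, for all s simultaneously, proves the identity.

open import Defs
open import Algebra.Bundles using (CommutativeRing)
open import Algebra.Solver.Ring.AlmostCommutativeRing using (_-Raw-AlmostCommutative⟶_; fromCommutativeRing)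
import Algebra.Solver.Ring as RingSolver
import Algebra.Properties.AbelianGroup as AbelianGroupProperties
import Algebra.Properties.Ring as RingProperties
import Algebra.Properties.Semiring.Mult.TCOptimised as SemiringMultTCOptimised
open import Data.Integer as ℤ using (ℤ; +_; -[1+_])
import Data.Integer.Properties as ℤ
open import Data.Maybe using (Maybe; just; nothing)
open import Data.Nat as ℕ using (ℕ; zero; suc; _∸_; _≤_; _^_)
import Data.Nat.Properties as ℕ
open import Data.Nat.Combinatorics using (_C_; nCk+nC[k+1]≡[n+1]C[k+1]; nC1≡n; nCk≡nC[n∸k])
open import Data.Nat.Tactic.RingSolver using (solve-∀)
open import Relation.Binary.PropositionalEquality as ≡ using (_≡_)
open import Relation.Nullary using (¬_; yes; no)

module IntegerCoefficients {c ℓ} (R : CommutativeRing c ℓ) where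
  open CommutativeRing R
  open RingProperties ring using (-‿involutive; -0#≈0#; -‿distribˡ-*; -‿distribʳ-*)
  open AbelianGroupProperties +-abelianGroup using (⁻¹-∙-comm)
  -- The optimised _×_ makes fromℤ (+ 1) reduce to 1#, so that the solver's
  -- constants agree definitionally with those of the ring.
  open SemiringMultTCOptimised semiring using (_×_; ×-homo-+; ×1-homo-*)
  open import Algebra.Properties.CommutativeSemigroup +-commutativeSemigroup using (interchange)
  open import Relation.Binary.Reasoning.Setoid setoid

  fromℤ : ℤ → Carrier
  fromℤ (+ n)    = n × 1#
  fromℤ -[1+ n ] = - (suc n × 1#)

  fromℤ-neg : ∀ i → fromℤ (ℤ.- i) ≈ - fromℤ i
  fromℤ-neg (+ zero)  = sym -0#≈0#
  fromℤ-neg (+ suc n) = refl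
  fromℤ-neg -[1+ n ]  = sym (-‿involutive _)

  fromℤ-⊖ : ∀ m n → fromℤ (m ℤ.⊖ n) ≈ m × 1# - n × 1#
  fromℤ-⊖ m       zero    = sym (trans (+-congˡ -0#≈0#) (+-identityʳ _))
  fromℤ-⊖ zero    (suc n) = sym (+-identityˡ _)
  fromℤ-⊖ (suc m) (suc n) = begin
    fromℤ (suc m ℤ.⊖ suc n)         ≡⟨ ≡.cong fromℤ (ℤ.[1+m]⊖[1+n]≡m⊖n m n) ⟩
    fromℤ (m ℤ.⊖ n)                 ≈⟨ fromℤ-⊖ m n ⟩
    m × 1# - n × 1#                 ≈⟨ +-identityˡ _ ⟨
    0# + (m × 1# - n × 1#)          ≈⟨ +-congʳ (-‿inverseʳ 1#) ⟨
    (1# - 1#) + (m × 1# - n × 1#)   ≈⟨ interchange 1# (m × 1#) (- 1#) (- (n × 1#)) ⟨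
    (1# + m × 1#) + (- 1# - n × 1#) ≈⟨ +-cong (×-homo-+ 1# 1 m) (trans (-‿cong (×-homo-+ 1# 1 n)) (sym (⁻¹-∙-comm 1# (n × 1#)))) ⟨
    suc m × 1# - suc n × 1#         ∎

  fromℤ-+ : ∀ i j → fromℤ (i ℤ.+ j) ≈ fromℤ i + fromℤ j
  fromℤ-+ (+ m)    (+ n)    = ×-homo-+ 1# m n
  fromℤ-+ (+ m)    -[1+ n ] = fromℤ-⊖ m (suc n)
  fromℤ-+ -[1+ m ] (+ n)    = trans (fromℤ-⊖ n (suc m)) (+-comm _ _)
  fromℤ-+ -[1+ m ] -[1+ n ] = begin
    - (suc (suc m ℕ.+ n) × 1#)     ≡⟨ ≡.cong (λ k → - (suc k × 1#)) (ℕ.+-suc m n) ⟨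
    - ((suc m ℕ.+ suc n) × 1#)     ≈⟨ -‿cong (×-homo-+ 1# (suc m) (suc n)) ⟩
    - (suc m × 1# + suc n × 1#)    ≈⟨ ⁻¹-∙-comm _ _ ⟨
    - (suc m × 1#) - (suc n × 1#)  ∎

  fromℤ-+* : ∀ m j → fromℤ (+ m ℤ.* j) ≈ fromℤ (+ m) * fromℤ j
  fromℤ-+* m (+ n)    = trans (reflexive (≡.cong fromℤ (≡.sym (ℤ.pos-* m n)))) (×1-homo-* m n)
  fromℤ-+* m -[1+ n ] = begin
    fromℤ (+ m ℤ.* ℤ.- + suc n)     ≡⟨ ≡.cong fromℤ (ℤ.neg-distribʳ-* (+ m) (+ suc n)) ⟨
    fromℤ (ℤ.- (+ m ℤ.* + suc n))   ≈⟨ fromℤ-neg (+ m ℤ.* + suc n) ⟩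
    - fromℤ (+ m ℤ.* + suc n)       ≈⟨ -‿cong (fromℤ-+* m (+ suc n)) ⟩
    - (m × 1# * suc n × 1#)         ≈⟨ -‿distribʳ-* _ _ ⟩
    m × 1# * - (suc n × 1#)         ∎

  fromℤ-* : ∀ i j → fromℤ (i ℤ.* j) ≈ fromℤ i * fromℤ j
  fromℤ-* (+ m)    j = fromℤ-+* m j
  fromℤ-* -[1+ m ] j = begin
    fromℤ (ℤ.- + suc m ℤ.* j)       ≡⟨ ≡.cong fromℤ (ℤ.neg-distribˡ-* (+ suc m) j) ⟨
    fromℤ (ℤ.- (+ suc m ℤ.* j))     ≈⟨ fromℤ-neg (+ suc m ℤ.* j) ⟩
    - fromℤ (+ suc m ℤ.* j)         ≈⟨ -‿cong (fromℤ-+* (suc m) j) ⟩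
    - (suc m × 1# * fromℤ j)        ≈⟨ -‿distribˡ-* _ _ ⟩
    - (suc m × 1#) * fromℤ j        ∎

  fromℤ-homomorphism : ℤ.+-*-rawRing -Raw-AlmostCommutative⟶ fromCommutativeRing R
  fromℤ-homomorphism = record
    { ⟦_⟧    = fromℤ
    ; +-homo = fromℤ-+
    ; *-homo = fromℤ-*
    ; -‿homo = fromℤ-neg
    ; 0-homo = refl
    ; 1-homo = refl
    }

  fromℤ-≟ : ∀ i j → Maybe (fromℤ i ≈ fromℤ j)
  fromℤ-≟ i j with i ℤ.≟ j
  ... | yes ≡.refl = just refl
  ... | no _       = nothing

  open RingSolver ℤ.+-*-rawRing (fromCommutativeRing R) fromℤ-homomorphism fromℤ-≟ public

module _ where
  open import Data.Nat.Base using (_+_; _*_)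

  k≤n⇒nCk>0 : ∀ {n k} → k ≤ n → n C k ℕ.> 0
  k≤n⇒nCk>0 {n}     {zero}  _         = ℕ.s≤s ℕ.z≤n
  k≤n⇒nCk>0 {suc n} {suc k} (ℕ.s≤s k≤n) = begin-strict
    0                     <⟨ k≤n⇒nCk>0 k≤n ⟩
    n C k                 ≤⟨ ℕ.m≤m+n (n C k) (n C suc k) ⟩
    n C k + n C suc k     ≡⟨ nCk+nC[k+1]≡[n+1]C[k+1] n k ⟩
    suc n C suc k         ∎
    where open ℕ.≤-Reasoning

  [1+k]*[1+n]C[1+k]≡[1+n]*nCk : ∀ n k → suc k * (suc n C suc k) ≡ suc n * (n C k)
  [1+k]*[1+n]C[1+k]≡[1+n]*nCk zero    zero    = ≡.refl
  [1+k]*[1+n]C[1+k]≡[1+n]*nCk zero    (suc k) = ℕ.*-zeroʳ (suc (suc k))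
  [1+k]*[1+n]C[1+k]≡[1+n]*nCk (suc n) zero    = ≡.trans (ℕ.+-identityʳ _) (≡.trans (nC1≡n (suc (suc n))) (≡.sym (ℕ.*-identityʳ _)))
  [1+k]*[1+n]C[1+k]≡[1+n]*nCk (suc n) (suc k) = begin
    (2 + k) * ((2 + n) C (2 + k))
      ≡⟨ ≡.cong ((2 + k) *_) (nCk+nC[k+1]≡[n+1]C[k+1] (suc n) (suc k)) ⟨
    (2 + k) * (c₁ + c₂)
      ≡⟨ regroup k c₁ c₂ ⟩
    c₁ + ((1 + k) * c₁ + (2 + k) * c₂)
      ≡⟨ ≡.cong₂ (λ x y → c₁ + (x + y)) ([1+k]*[1+n]C[1+k]≡[1+n]*nCk n k) ([1+k]*[1+n]C[1+k]≡[1+n]*nCk n (suc k)) ⟩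
    c₁ + ((1 + n) * (n C k) + (1 + n) * (n C suc k))
      ≡⟨ ≡.cong (_+_ c₁) (ℕ.*-distribˡ-+ (1 + n) (n C k) (n C suc k)) ⟨
    c₁ + (1 + n) * (n C k + n C suc k)
      ≡⟨ ≡.cong (λ x → c₁ + (1 + n) * x) (nCk+nC[k+1]≡[n+1]C[k+1] n k) ⟩
    (2 + n) * c₁ ∎
    where
    open ≡.≡-Reasoning
    c₁ = suc n C suc k
    c₂ = suc n C suc (suc k)
    regroup : ∀ k x y → (2 + k) * (x + y) ≡ x + ((1 + k) * x + (2 + k) * y)
    regroup = solve-∀

  [1+n∸k]*[1+n]Ck≡[1+n]*nCk : ∀ {n k} → k ≤ n → (suc n ∸ k) * (suc n C k) ≡ suc n * (n C k)
  [1+n∸k]*[1+n]Ck≡[1+n]*nCk {n} {k} k≤n = begin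
    (suc n ∸ k) * (suc n C k)                    ≡⟨ ≡.cong₂ _*_ (ℕ.+-∸-assoc 1 k≤n) (nCk≡nC[n∸k] (ℕ.m≤n⇒m≤1+n k≤n)) ⟩
    suc (n ∸ k) * (suc n C (suc n ∸ k))          ≡⟨ ≡.cong (λ j → suc (n ∸ k) * (suc n C j)) (ℕ.+-∸-assoc 1 k≤n) ⟩
    suc (n ∸ k) * (suc n C suc (n ∸ k))          ≡⟨ [1+k]*[1+n]C[1+k]≡[1+n]*nCk n (n ∸ k) ⟩
    suc n * (n C (n ∸ k))                        ≡⟨ ≡.cong (suc n *_) (nCk≡nC[n∸k] k≤n) ⟨
    suc n * (n C k)                              ∎
    where open ≡.≡-Reasoning

module RingιProperties {c ℓ} (R : CommutativeRing c ℓ) where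
  open CommutativeRing R
  open import Algebra.Properties.Semiring.Mult semiring using (_×_; ×-homo-+; ×1-homo-*)

  private
    ι : ℕ → Carrier
    ι = ringι R

  ι≈×1# : ∀ n → ι n ≈ n × 1#
  ι≈×1# zero    = refl
  ι≈×1# (suc n) = +-congˡ (ι≈×1# n)

  ι-+ : ∀ m n → ι (m ℕ.+ n) ≈ ι m + ι n
  ι-+ m n = trans (ι≈×1# (m ℕ.+ n)) (trans (×-homo-+ 1# m n) (sym (+-cong (ι≈×1# m) (ι≈×1# n))))

  ι-* : ∀ m n → ι (m ℕ.* n) ≈ ι m * ι n
  ι-* m n = trans (ι≈×1# (m ℕ.* n)) (trans (×1-homo-* m n) (sym (*-cong (ι≈×1# m) (ι≈×1# n))))

  ι-*-≡ : ∀ p q r t → p ℕ.* q ≡ r ℕ.* t → ι p * ι q ≈ ι r * ι t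
  ι-*-≡ p q r t pq≡rt = trans (sym (ι-* p q)) (trans (reflexive (≡.cong ι pq≡rt)) (ι-* r t))

  ι-1 : ι 1 ≈ 1#
  ι-1 = +-identityʳ 1#

module CharZeroFieldProperties {c ℓ} (F : CharZeroField c ℓ) where
  open FieldOps F
  open RingιProperties cring public using (ι-+; ι-*; ι-*-≡; ι-1)
  open IntegerCoefficients cring using (solve; _:=_; _:+_; _:*_; _:-_; con)
  open import Algebra.Properties.CommutativeSemigroup +-commutativeSemigroup using (interchange)
  open import Relation.Binary.Reasoning.Setoid setoid

  1≉0 : 1# ≉ 0#
  1≉0 1≈0 = char0 0 (trans ι-1 1≈0)

  ι≉0 : ∀ {n} → n ℕ.> 0 → ι n ≉ 0#
  ι≉0 {suc n} _ = char0 n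

  ⁻¹-unique : ∀ {x y} → x * y ≈ 1# → y ≈ x ⁻¹
  ⁻¹-unique {x} {y} xy≈1 = begin
    y                ≈⟨ *-identityˡ y ⟨
    1# * y           ≈⟨ *-congʳ (inverseˡ x x≉0) ⟨
    (x ⁻¹ * x) * y   ≈⟨ *-assoc _ _ _ ⟩
    x ⁻¹ * (x * y)   ≈⟨ *-congˡ xy≈1 ⟩
    x ⁻¹ * 1#        ≈⟨ *-identityʳ _ ⟩
    x ⁻¹             ∎
    where
    x≉0 : x ≉ 0#
    x≉0 x≈0 = 1≉0 (trans (sym xy≈1) (trans (*-congʳ x≈0) (zeroˡ y)))

  ⁻¹-cong : ∀ {x y} → x ≉ 0# → x ≈ y → x ⁻¹ ≈ y ⁻¹
  ⁻¹-cong {x} x≉0 x≈y = ⁻¹-unique (trans (*-congʳ (sym x≈y)) (inverseʳ x x≉0))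

  *-≉0 : ∀ {x y} → x ≉ 0# → y ≉ 0# → x * y ≉ 0#
  *-≉0 {x} {y} x≉0 y≉0 xy≈0 = y≉0 (begin
    y                ≈⟨ *-identityˡ y ⟨
    1# * y           ≈⟨ *-congʳ (inverseˡ x x≉0) ⟨
    (x ⁻¹ * x) * y   ≈⟨ *-assoc _ _ _ ⟩
    x ⁻¹ * (x * y)   ≈⟨ *-congˡ xy≈0 ⟩
    x ⁻¹ * 0#        ≈⟨ zeroʳ _ ⟩
    0#               ∎)

  ⁻¹-distrib-* : ∀ {x y} → x ≉ 0# → y ≉ 0# → (x * y) ⁻¹ ≈ x ⁻¹ * y ⁻¹
  ⁻¹-distrib-* {x} {y} x≉0 y≉0 = sym (⁻¹-unique (begin
    (x * y) * (x ⁻¹ * y ⁻¹)   ≈⟨ solve 4 (λ x y x′ y′ → (x :* y) :* (x′ :* y′) := (x :* x′) :* (y :* y′)) refl x y (x ⁻¹) (y ⁻¹) ⟩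
    (x * x ⁻¹) * (y * y ⁻¹)   ≈⟨ *-cong (inverseʳ x x≉0) (inverseʳ y y≉0) ⟩
    1# * 1#                   ≈⟨ *-identityˡ 1# ⟩
    1#                        ∎))

  *-/-cancelˡ : ∀ {x y z} → x ≉ 0# → z ≉ 0# → (x * y) / (x * z) ≈ y / z
  *-/-cancelˡ {x} {y} {z} x≉0 z≉0 = begin
    (x * y) * (x * z) ⁻¹      ≈⟨ *-congˡ (⁻¹-distrib-* x≉0 z≉0) ⟩
    (x * y) * (x ⁻¹ * z ⁻¹)   ≈⟨ solve 4 (λ x y x′ z′ → (x :* y) :* (x′ :* z′) := (x :* x′) :* (y :* z′)) refl x y (x ⁻¹) (z ⁻¹) ⟩
    (x * x ⁻¹) * (y * z ⁻¹)   ≈⟨ *-congʳ (inverseʳ x x≉0) ⟩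
    1# * (y * z ⁻¹)           ≈⟨ *-identityˡ _ ⟩
    y / z                     ∎

  sumTo-cong : ∀ n {f g : ℕ → Carrier} → (∀ k → k ℕ.< n → f k ≈ g k) → sumTo n f ≈ sumTo n g
  sumTo-cong zero    f≈g = refl
  sumTo-cong (suc n) f≈g = +-cong (sumTo-cong n (λ k k<n → f≈g k (ℕ.m<n⇒m<1+n k<n))) (f≈g n (ℕ.n<1+n n))

  sumTo-+ : ∀ n (f g : ℕ → Carrier) → sumTo n (λ k → f k + g k) ≈ sumTo n f + sumTo n g
  sumTo-+ zero    f g = sym (+-identityˡ 0#)
  sumTo-+ (suc n) f g = begin
    sumTo n (λ k → f k + g k) + (f n + g n)   ≈⟨ +-congʳ (sumTo-+ n f g) ⟩
    (sumTo n f + sumTo n g) + (f n + g n)     ≈⟨ interchange _ _ _ _ ⟩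
    (sumTo n f + f n) + (sumTo n g + g n)     ∎

  sumTo-*ˡ : ∀ n x (f : ℕ → Carrier) → x * sumTo n f ≈ sumTo n (λ k → x * f k)
  sumTo-*ˡ zero    x f = zeroʳ x
  sumTo-*ˡ (suc n) x f = trans (distribˡ x _ _) (+-congʳ (sumTo-*ˡ n x f))

  sumTo-suc : ∀ n (f : ℕ → Carrier) → sumTo (suc n) f ≈ f 0 + sumTo n (λ k → f (suc k))
  sumTo-suc zero    f = +-comm 0# (f 0)
  sumTo-suc (suc n) f = trans (+-congʳ (sumTo-suc n f)) (+-assoc _ _ _)

  falling-cong : ∀ {x y} k → x ≈ y → falling x k ≈ falling y k
  falling-cong zero    x≈y = refl
  falling-cong (suc k) x≈y = *-cong (falling-cong k x≈y) (+-congʳ x≈y)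

  binom-cong : ∀ {x y} k → x ≈ y → binom x k ≈ binom y k
  binom-cong k x≈y = *-congʳ (falling-cong k x≈y)

  binom-zero : ∀ x → binom x 0 ≈ 1#
  binom-zero x = trans (*-identityˡ _) (sym (⁻¹-unique (trans (*-identityʳ _) ι-1)))

  falling-pascal : ∀ x k → falling (x + 1#) (suc k) ≈ falling x (suc k) + ι (suc k) * falling x k
  falling-pascal x zero    =
    solve 1 (λ x → con (+ 1) :* ((x :+ con (+ 1)) :- con (+ 0))
                   := con (+ 1) :* (x :- con (+ 0)) :+ (con (+ 1) :+ con (+ 0)) :* con (+ 1)) refl x
  falling-pascal x (suc k) = begin
    falling (x + 1#) (suc k) * ((x + 1#) - ι (suc k))
      ≈⟨ *-congʳ (falling-pascal x k) ⟩
    (falling x (suc k) + ι (suc k) * falling x k) * ((x + 1#) - ι (suc k))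
      ≈⟨ solve 3 (λ f x m → (f :* (x :- m) :+ (con (+ 1) :+ m) :* f) :* ((x :+ con (+ 1)) :- (con (+ 1) :+ m))
                          := f :* (x :- m) :* (x :- (con (+ 1) :+ m)) :+ (con (+ 1) :+ (con (+ 1) :+ m)) :* (f :* (x :- m)))
                 refl (falling x k) x (ι k) ⟩
    falling x (suc (suc k)) + ι (suc (suc k)) * falling x (suc k)
      ∎

  ι[k!]≉0 : ∀ k → ι (k ℕ.!) ≉ 0#
  ι[k!]≉0 k = ι≉0 (ℕ.1≤n! k)

  binom-pascal : ∀ x k → binom (x + 1#) (suc k) ≈ binom x (suc k) + binom x k
  binom-pascal x k = begin
    falling (x + 1#) (suc k) / ι (suc k ℕ.!)
      ≈⟨ *-congʳ (falling-pascal x k) ⟩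
    (falling x (suc k) + ι (suc k) * falling x k) / ι (suc k ℕ.!)
      ≈⟨ distribʳ _ _ _ ⟩
    binom x (suc k) + (ι (suc k) * falling x k) / ι (suc k ℕ.!)
      ≈⟨ +-congˡ (*-congˡ (⁻¹-cong (ι[k!]≉0 (suc k)) (ι-* (suc k) (k ℕ.!)))) ⟩
    binom x (suc k) + (ι (suc k) * falling x k) / (ι (suc k) * ι (k ℕ.!))
      ≈⟨ +-congˡ (*-/-cancelˡ (char0 k) (ι[k!]≉0 k)) ⟩
    binom x (suc k) + binom x k
      ∎

  binom-suc : ∀ x k → binom x (suc k) ≈ binom x k * (x - ι k) / ι (suc k)
  binom-suc x k = begin
    (falling x k * (x - ι k)) * ι (suc k ℕ.!) ⁻¹
      ≈⟨ *-congˡ (⁻¹-cong (ι[k!]≉0 (suc k)) (ι-* (suc k) (k ℕ.!))) ⟩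
    (falling x k * (x - ι k)) * (ι (suc k) * ι (k ℕ.!)) ⁻¹
      ≈⟨ *-congˡ (⁻¹-distrib-* (char0 k) (ι[k!]≉0 k)) ⟩
    (falling x k * (x - ι k)) * (ι (suc k) ⁻¹ * ι (k ℕ.!) ⁻¹)
      ≈⟨ solve 4 (λ f y a b → (f :* y) :* (a :* b) := f :* b :* y :* a) refl (falling x k) (x - ι k) (ι (suc k) ⁻¹) (ι (k ℕ.!) ⁻¹) ⟩
    binom x k * (x - ι k) / ι (suc k)
      ∎

  *-/-cancelʳ : ∀ {x y z} → x ≉ 0# → z ≉ 0# → (y * x) / (z * x) ≈ y / z
  *-/-cancelʳ {x} {y} {z} x≉0 z≉0 =
    trans (*-cong (*-comm y x) (⁻¹-cong (*-≉0 z≉0 x≉0) (*-comm z x))) (*-/-cancelˡ x≉0 z≉0)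

  /-rescale : ∀ {x y z w} → y ≉ 0# → z ≉ 0# → y * z ≈ w → x / y ≈ (x * z) / w
  /-rescale {x} {y} {z} {w} y≉0 z≉0 yz≈w = begin
    x / y              ≈⟨ *-/-cancelʳ z≉0 y≉0 ⟨
    (x * z) / (y * z)  ≈⟨ *-congˡ (⁻¹-cong (*-≉0 y≉0 z≉0) yz≈w) ⟩
    (x * z) / w        ∎

module HarmonicBinomialIdentity {c ℓ} (F : CharZeroField c ℓ) where
  open FieldOps F
  open CharZeroFieldProperties F
  open IntegerCoefficients cring using (solve; _:=_; _:+_; _:*_; _:-_; :-_; con)
  open RingProperties ring using (-‿distribˡ-*)
  open import Relation.Binary.Reasoning.Setoid setoid

  a : ℕ → Carrier → Carrier
  a k s = sgn k * binom (s + ι k) (suc k)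

  g : ℕ → Carrier → Carrier
  g k s = sgn k * binom (s + ι k) k

  +-ι-shift : ∀ s k → s + ι (suc k) ≈ (s + 1#) + ι k
  +-ι-shift s k = sym (+-assoc s 1# (ι k))

  a-absorption : ∀ k s w → s * (sgn k / ι (suc k) * binom (s + ι k) k * w) ≈ a k s * w
  a-absorption k s w = begin
    s * (sgn k * ι (suc k) ⁻¹ * binom (s + ι k) k * w)
      ≈⟨ solve 6 (λ s ε i b w m → s :* (ε :* i :* b :* w) := ε :* (b :* ((s :+ m) :- m) :* i) :* w)
                 refl s (sgn k) (ι (suc k) ⁻¹) (binom (s + ι k) k) w (ι k) ⟩
    sgn k * (binom (s + ι k) k * ((s + ι k) - ι k) / ι (suc k)) * w
      ≈⟨ *-congʳ (*-congˡ (binom-suc (s + ι k) k)) ⟨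
    a k s * w
      ∎

  a-pascal : ∀ k s → a k s ≈ a k (s + 1#) - g k s
  a-pascal k s = begin
    sgn k * binom x (suc k)
      ≈⟨ solve 3 (λ ε b c → ε :* b := ε :* (b :+ c) :- ε :* c) refl (sgn k) (binom x (suc k)) (binom x k) ⟩
    sgn k * (binom x (suc k) + binom x k) - g k s
      ≈⟨ +-congʳ (*-congˡ (binom-pascal x k)) ⟨
    sgn k * binom (x + 1#) (suc k) - g k s
      ≈⟨ +-congʳ (*-congˡ (binom-cong (suc k) x+1≈)) ⟩
    a k (s + 1#) - g k s
      ∎
    where
    x = s + ι k
    x+1≈ : x + 1# ≈ (s + 1#) + ι k
    x+1≈ = solve 2 (λ s m → (s :+ m) :+ con (+ 1) := (s :+ con (+ 1)) :+ m) refl s (ι k)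

  g-zero : ∀ s → g 0 s ≈ 1#
  g-zero s = trans (*-identityˡ _) (binom-zero (s + 0#))

  g-suc : ∀ k s → g (suc k) s ≈ - a k (s + 1#)
  g-suc k s = trans (*-congˡ (binom-cong (suc k) (+-ι-shift s k))) (sym (-‿distribˡ-* _ _))

  1/ι[1+n]^1≈ : ∀ n → 1# / ι (suc n ^ 1) ≈ ι (suc n) ⁻¹
  1/ι[1+n]^1≈ n = trans (*-identityˡ _) (⁻¹-cong (ι≉0 (ℕ.m^n>0 (suc n) 1)) (reflexive (≡.cong ι (ℕ.*-identityʳ (suc n)))))

  1/ι[1+n]^2≈ : ∀ n → 1# / ι (suc n ^ 2) ≈ ι (suc n) ⁻¹ * ι (suc n) ⁻¹
  1/ι[1+n]^2≈ n = begin
    1# * ι (suc n ^ 2) ⁻¹          ≈⟨ *-identityˡ _ ⟩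
    ι (suc n ^ 2) ⁻¹               ≈⟨ ⁻¹-cong (ι≉0 (ℕ.m^n>0 (suc n) 2)) ι[1+n]^2≈ ⟩
    (ι (suc n) * ι (suc n)) ⁻¹     ≈⟨ ⁻¹-distrib-* (char0 n) (char0 n) ⟩
    ι (suc n) ⁻¹ * ι (suc n) ⁻¹    ∎
    where
    ι[1+n]^2≈ : ι (suc n ^ 2) ≈ ι (suc n) * ι (suc n)
    ι[1+n]^2≈ = trans (reflexive (≡.cong (λ m → ι (suc n ℕ.* m)) (ℕ.*-identityʳ (suc n)))) (ι-* (suc n) (suc n))

  H-suc : ∀ n → H (suc n) ≈ H n + ι (suc n) ⁻¹
  H-suc n = +-congˡ (1/ι[1+n]^1≈ n)

  H²-suc : ∀ n → Hr 2 (suc n) ≈ Hr 2 n + ι (suc n) ⁻¹ * ι (suc n) ⁻¹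
  H²-suc n = +-congˡ (1/ι[1+n]^2≈ n)

  W : ℕ → ℕ → Carrier
  W n k = (H n - H k) / (ι (n ∸ k) * ι (n C k))

  A : ℕ → Carrier
  A n = (H n * H n + Hr 2 n) / ι 2

  W-first : ∀ n → W (suc n) 0 ≈ H (suc n) * ι (suc n) ⁻¹
  W-first n = *-cong (solve 1 (λ h → h :- con (+ 0) := h) refl (H (suc n)))
                     (⁻¹-cong (*-≉0 (char0 n) (char0 0)) (trans (*-congˡ ι-1) (*-identityʳ _)))

  W-last : ∀ n → W (suc n) n ≈ ι (suc n) ⁻¹ * ι (suc n) ⁻¹
  W-last n = begin
    (H (suc n) - H n) / (ι (suc n ∸ n) * ι (suc n C n))
      ≈⟨ *-cong (+-congʳ (H-suc n)) (sym (⁻¹-cong (char0 n) (sym denominator≈))) ⟩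
    ((H n + ι (suc n) ⁻¹) - H n) / ι (suc n)
      ≈⟨ *-congʳ (solve 2 (λ h i → (h :+ i) :- h := i) refl (H n) (ι (suc n) ⁻¹)) ⟩
    ι (suc n) ⁻¹ * ι (suc n) ⁻¹
      ∎
    where
    [1+n]Cn≡1+n : suc n C n ≡ suc n
    [1+n]Cn≡1+n = ≡.trans (nCk≡nC[n∸k] (ℕ.n≤1+n n)) (≡.trans (≡.cong (suc n C_) (ℕ.m+n∸n≡m 1 n)) (nC1≡n (suc n)))
    denominator≡ : (suc n ∸ n) ℕ.* (suc n C n) ≡ suc n
    denominator≡ = ≡.trans (≡.cong₂ ℕ._*_ (ℕ.m+n∸n≡m 1 n) [1+n]Cn≡1+n) (ℕ.*-identityˡ (suc n))
    denominator≈ : ι (suc n ∸ n) * ι (suc n C n) ≈ ι (suc n)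
    denominator≈ = trans (sym (ι-* (suc n ∸ n) (suc n C n))) (reflexive (≡.cong ι denominator≡))

  A-suc : ∀ n → A (suc n) ≈ A n + W (suc n) 0
  A-suc n = begin
    (H (suc n) * H (suc n) + Hr 2 (suc n)) * ι 2 ⁻¹
      ≈⟨ *-congʳ (+-cong (*-cong (H-suc n) (H-suc n)) (H²-suc n)) ⟩
    ((h + i) * (h + i) + (h₂ + i * i)) * ι 2 ⁻¹
      ≈⟨ solve 4 (λ h h₂ i t → ((h :+ i) :* (h :+ i) :+ (h₂ :+ i :* i)) :* t
                              := (h :* h :+ h₂) :* t :+ (h :+ i) :* i :* ((con (+ 1) :+ con (+ 1)) :* t))
                 refl h h₂ i (ι 2 ⁻¹) ⟩
    A n + (h + i) * i * ((1# + 1#) * ι 2 ⁻¹)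
      ≈⟨ +-congˡ (trans (*-congˡ [1+1]/2≈1) (*-identityʳ _)) ⟩
    A n + (h + i) * i
      ≈⟨ +-congˡ (trans (W-first n) (*-congʳ (H-suc n))) ⟨
    A n + W (suc n) 0
      ∎
    where
    h = H n
    h₂ = Hr 2 n
    i = ι (suc n) ⁻¹
    [1+1]/2≈1 : (1# + 1#) * ι 2 ⁻¹ ≈ 1#
    [1+1]/2≈1 = trans (*-congʳ (+-congˡ (sym ι-1))) (inverseʳ (ι 2) (char0 1))

  common-denominator : ℕ → ℕ → Carrier
  common-denominator n k = ι (suc n) * (ι (n ∸ k) * ι (n C k))

  W[1+n,k]≈ : ∀ {n k} → k ℕ.< n →
              W (suc n) k ≈ ((H n - H k + ι (suc n) ⁻¹) * ι (n ∸ k)) / common-denominator n k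
  W[1+n,k]≈ {n} {k} k<n = trans
    (*-congʳ (trans (+-congʳ (H-suc n)) (solve 3 (λ x y z → (x :+ z) :- y := (x :- y) :+ z) refl (H n) (H k) (ι (suc n) ⁻¹))))
    (/-rescale (*-≉0 (ι≉0 (ℕ.m<n⇒0<n∸m (ℕ.m<n⇒m<1+n k<n))) (ι≉0 (k≤n⇒nCk>0 (ℕ.m≤n⇒m≤1+n k≤n))))
               (ι≉0 (ℕ.m<n⇒0<n∸m k<n)) denominator≈)
    where
    k≤n = ℕ.<⇒≤ k<n
    denominator≈ : ι (suc n ∸ k) * ι (suc n C k) * ι (n ∸ k) ≈ common-denominator n k
    denominator≈ = begin
      ι (suc n ∸ k) * ι (suc n C k) * ι (n ∸ k)
        ≈⟨ *-congʳ (ι-*-≡ (suc n ∸ k) (suc n C k) (suc n) (n C k) ([1+n∸k]*[1+n]Ck≡[1+n]*nCk k≤n)) ⟩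
      ι (suc n) * ι (n C k) * ι (n ∸ k)
        ≈⟨ solve 3 (λ N b M → N :* b :* M := N :* (M :* b)) refl (ι (suc n)) (ι (n C k)) (ι (n ∸ k)) ⟩
      common-denominator n k
        ∎

  W[1+n,1+k]≈ : ∀ {n k} → k ℕ.< n →
                W (suc n) (suc k) ≈ ((H n - H k + ι (suc n) ⁻¹ - ι (suc k) ⁻¹) * ι (suc k)) / common-denominator n k
  W[1+n,1+k]≈ {n} {k} k<n = trans
    (*-congʳ (trans (+-cong (H-suc n) (-‿cong (H-suc k)))
      (solve 4 (λ x y z w → (x :+ z) :- (y :+ w) := (x :- y) :+ z :- w) refl (H n) (H k) (ι (suc n) ⁻¹) (ι (suc k) ⁻¹))))
    (/-rescale (*-≉0 (ι≉0 (ℕ.m<n⇒0<n∸m k<n)) (ι≉0 (k≤n⇒nCk>0 (ℕ.s≤s (ℕ.<⇒≤ k<n))))) (char0 k) denominator≈)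
    where
    M = ι (n ∸ k)
    C′ = ι (suc n C suc k)
    denominator≈ : M * C′ * ι (suc k) ≈ common-denominator n k
    denominator≈ = begin
      M * C′ * ι (suc k)
        ≈⟨ solve 3 (λ M C K → M :* C :* K := M :* (K :* C)) refl M C′ (ι (suc k)) ⟩
      M * (ι (suc k) * C′)
        ≈⟨ *-congˡ (ι-*-≡ (suc k) (suc n C suc k) (suc n) (n C k) ([1+k]*[1+n]C[1+k]≡[1+n]*nCk n k)) ⟩
      M * (ι (suc n) * ι (n C k))
        ≈⟨ solve 3 (λ M N b → M :* (N :* b) := N :* (M :* b)) refl M (ι (suc n)) (ι (n C k)) ⟩
      common-denominator n k
        ∎

  -- With h = H n - H k, m = n - k and k, n standing for k + 1, n + 1: the two
  -- numerators above add up to (n + 1) h.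
  telescoping-numerator : ∀ {h m k n} → m + k ≈ n → k ≉ 0# → n ≉ 0# →
                          (h + n ⁻¹) * m + (h + n ⁻¹ - k ⁻¹) * k ≈ n * h
  telescoping-numerator {h} {m} {k} {n} m+k≈n k≉0 n≉0 = begin
    (h + n ⁻¹) * m + (h + n ⁻¹ - k ⁻¹) * k
      ≈⟨ solve 5 (λ h m k n′ k′ → (h :+ n′) :* m :+ (h :+ n′ :- k′) :* k := (h :+ n′) :* (m :+ k) :- k :* k′) refl h m k (n ⁻¹) (k ⁻¹) ⟩
    (h + n ⁻¹) * (m + k) - k * k ⁻¹
      ≈⟨ +-cong (*-congˡ m+k≈n) (-‿cong (inverseʳ k k≉0)) ⟩
    (h + n ⁻¹) * n - 1#
      ≈⟨ solve 3 (λ h n n′ → (h :+ n′) :* n :- con (+ 1) := n :* h :+ (n :* n′ :- con (+ 1))) refl h n (n ⁻¹) ⟩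
    n * h + (n * n ⁻¹ - 1#)
      ≈⟨ +-congˡ (trans (+-congʳ (inverseʳ n n≉0)) (-‿inverseʳ 1#)) ⟩
    n * h + 0#
      ≈⟨ +-identityʳ _ ⟩
    n * h
      ∎

  W-pascal : ∀ {n k} → k ℕ.< n → W (suc n) k + W (suc n) (suc k) ≈ W n k
  W-pascal {n} {k} k<n = begin
    W (suc n) k + W (suc n) (suc k)
      ≈⟨ +-cong (W[1+n,k]≈ k<n) (W[1+n,1+k]≈ k<n) ⟩
    ((h + N ⁻¹) * M) / Δ + ((h + N ⁻¹ - K ⁻¹) * K) / Δ
      ≈⟨ distribʳ _ _ _ ⟨
    ((h + N ⁻¹) * M + (h + N ⁻¹ - K ⁻¹) * K) / Δ
      ≈⟨ *-congʳ (telescoping-numerator M+K≈N (char0 k) (char0 n)) ⟩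
    (N * h) / (N * (M * ι (n C k)))
      ≈⟨ *-/-cancelˡ (char0 n) (*-≉0 (ι≉0 (ℕ.m<n⇒0<n∸m k<n)) (ι≉0 (k≤n⇒nCk>0 (ℕ.<⇒≤ k<n)))) ⟩
    W n k
      ∎
    where
    h = H n - H k
    M = ι (n ∸ k)
    K = ι (suc k)
    N = ι (suc n)
    Δ = common-denominator n k
    M+K≈N : M + K ≈ N
    M+K≈N = trans (sym (ι-+ (n ∸ k) (suc k)))
      (reflexive (≡.cong ι (≡.trans (ℕ.+-suc (n ∸ k) k) (≡.cong suc (ℕ.m∸n+n≡m (ℕ.<⇒≤ k<n))))))

  lhs : ℕ → Carrier → Carrier
  lhs n s = sumTo n (λ j → binom (s + ι n) (suc j) * sgn j / ι (suc j ^ 2))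

  rhs : ℕ → Carrier → Carrier
  rhs n s = A n + sumTo n (λ k → a k s * W n k)

  lhs-suc : ∀ n s → lhs (suc n) s ≈ lhs n (s + 1#) + a n (s + 1#) * (ι (suc n) ⁻¹ * ι (suc n) ⁻¹)
  lhs-suc n s = +-cong
    (sumTo-cong n (λ j _ → *-congʳ (*-congʳ (binom-cong (suc j) (+-ι-shift s n)))))
    (*-cong (trans (*-comm _ _) (*-congˡ (binom-cong (suc n) (+-ι-shift s n))))
            (trans (sym (*-identityˡ _)) (1/ι[1+n]^2≈ n)))

  ΣaW-suc : ∀ n s → sumTo (suc n) (λ k → a k s * W (suc n) k)
                    ≈ sumTo n (λ k → a k (s + 1#) * W n k) + a n (s + 1#) * W (suc n) n - W (suc n) 0
  ΣaW-suc n s = begin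
    sumTo (suc n) (λ k → a k s * W′ k)
      ≈⟨ sumTo-cong (suc n) (λ k _ → split k) ⟩
    sumTo (suc n) (λ k → a k t * W′ k + - (g k s * W′ k))
      ≈⟨ sumTo-+ (suc n) _ _ ⟩
    (S₀ + a n t * W′ n) + sumTo (suc n) (λ k → - (g k s * W′ k))
      ≈⟨ +-congˡ (sumTo-suc n _) ⟩
    (S₀ + a n t * W′ n) + (- (g 0 s * W′ 0) + sumTo n (λ k → - (g (suc k) s * W′ (suc k))))
      ≈⟨ +-congˡ (+-cong (-‿cong (trans (*-congʳ (g-zero s)) (*-identityˡ _))) (sumTo-cong n (λ k _ → shifted k))) ⟩
    (S₀ + a n t * W′ n) + (- W′ 0 + S₁)
      ≈⟨ solve 4 (λ S₀ x w S₁ → (S₀ :+ x) :+ (:- w :+ S₁) := (S₀ :+ S₁) :+ x :- w) refl S₀ (a n t * W′ n) (W′ 0) S₁ ⟩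
    (S₀ + S₁) + a n t * W′ n - W′ 0
      ≈⟨ +-congʳ (+-congʳ S₀+S₁≈) ⟩
    sumTo n (λ k → a k t * W n k) + a n t * W′ n - W′ 0
      ∎
    where
    t = s + 1#
    W′ = W (suc n)
    S₀ = sumTo n (λ k → a k t * W′ k)
    S₁ = sumTo n (λ k → a k t * W′ (suc k))
    split : ∀ k → a k s * W′ k ≈ a k t * W′ k + - (g k s * W′ k)
    split k = trans (*-congʳ (a-pascal k s))
      (solve 3 (λ x y w → (x :- y) :* w := x :* w :+ :- (y :* w)) refl (a k t) (g k s) (W′ k))
    shifted : ∀ k → - (g (suc k) s * W′ (suc k)) ≈ a k t * W′ (suc k)
    shifted k = trans (-‿cong (*-congʳ (g-suc k s)))
      (solve 2 (λ x w → :- ((:- x) :* w) := x :* w) refl (a k t) (W′ (suc k)))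
    S₀+S₁≈ : S₀ + S₁ ≈ sumTo n (λ k → a k t * W n k)
    S₀+S₁≈ = trans (sym (sumTo-+ n _ _))
      (sumTo-cong n (λ k k<n → trans (sym (distribˡ _ _ _)) (*-congˡ (W-pascal k<n))))

  rhs-suc : ∀ n s → rhs (suc n) s ≈ rhs n (s + 1#) + a n (s + 1#) * (ι (suc n) ⁻¹ * ι (suc n) ⁻¹)
  rhs-suc n s = begin
    A (suc n) + sumTo (suc n) (λ k → a k s * W (suc n) k)
      ≈⟨ +-cong (A-suc n) (ΣaW-suc n s) ⟩
    (A n + W (suc n) 0) + (sumTo n (λ k → a k t * W n k) + a n t * W (suc n) n - W (suc n) 0)
      ≈⟨ solve 4 (λ A w S x → (A :+ w) :+ (S :+ x :- w) := (A :+ S) :+ x) refl (A n) (W (suc n) 0) (sumTo n (λ k → a k t * W n k)) (a n t * W (suc n) n) ⟩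
    rhs n t + a n t * W (suc n) n
      ≈⟨ +-congˡ (*-congˡ (W-last n)) ⟩
    rhs n t + a n t * (ι (suc n) ⁻¹ * ι (suc n) ⁻¹)
      ∎
    where t = s + 1#

  lhs≈rhs : ∀ n s → lhs n s ≈ rhs n s
  lhs≈rhs zero    s = solve 1 (λ t → con (+ 0) := (con (+ 0) :* con (+ 0) :+ con (+ 0)) :* t :+ con (+ 0)) refl (ι 2 ⁻¹)
  lhs≈rhs (suc n) s = begin
    lhs (suc n) s                  ≈⟨ lhs-suc n s ⟩
    lhs n (s + 1#) + last          ≈⟨ +-congʳ (lhs≈rhs n (s + 1#)) ⟩
    rhs n (s + 1#) + last          ≈⟨ rhs-suc n s ⟨
    rhs (suc n) s                  ∎
    where last = a n (s + 1#) * (ι (suc n) ⁻¹ * ι (suc n) ⁻¹)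

theorem2p9 : ∀ {c ℓ} (F : CharZeroField c ℓ) → let open FieldOps F in
    (n : ℕ) → 1 ≤ n → (s : Carrier) → (∀ m → ¬ (s + ι (suc m) ≈ 0#)) →
    sumTo n (λ j → binom (s + ι n) (suc j) * sgn j / ι (suc j ^ 2))
      ≈ (H n * H n + Hr 2 n) / ι 2
        + s * sumTo n (λ k → sgn k / ι (suc k) * binom (s + ι k) k
                              * ((H n - H k) / (ι (n ∸ k) * ι (n C k))))
theorem2p9 F n _ s _ = trans (lhs≈rhs n s)
  (+-congˡ (sym (trans (sumTo-*ˡ n s _) (sumTo-cong n (λ k _ → a-absorption k s (W n k))))))
  where
  open FieldOps F
  open CharZeroFieldProperties F using (sumTo-*ˡ; sumTo-cong)
  open HarmonicBinomialIdentity F
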